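{- Let $k\ge 1$ and let $\{\alpha_j,\beta_j,\gamma_j\}_{1\le j\le k}$ be $3k$ integers such that: they are pairwise distinct, nonzero and between $1$ and $3k+1$; no two of them sum to $6k+1$ (equivalently, exactly one of the integers $3k$ and $3k+1$ occurs among them); and $j=\alpha_j<\beta_j<\gamma_j$ and $\alpha_j+\beta_j=\gamma_j$ for every $1\le j\le k$. Suppose that $S:=6k+1$ is prime. Then the sums $\alpha:=\sum_{j=1}^k\alpha_j$, $\beta:=\sum_{j=1}^k\beta_j$ and $\gamma:=\sum_{j=1}^k\gamma_j$ are coprime to $S$. -}

module Defs where

open import Data.Nat using (ℕ; suc; _+_; _*_; _≤_; _<_)
open import Data.Fin using (Fin; toℕ)
open import Data.Product using (_×_; _,_)
open import Data.Vec.Functional using (Vector)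
import Data.Vec.Functional as VF
open import Relation.Binary.PropositionalEquality using (_≡_)
open import Relation.Nullary using (¬_)

-- The 3k integers, labelled by (which of α/β/γ, index j).
-- Position 0 = α, 1 = β, 2 = γ.  Indices j ∈ {1..k} are represented by Fin k (j = toℕ i + 1).
family : ∀ {k} → (Fin k → ℕ) → (Fin k → ℕ) → (Fin k → ℕ) → Fin 3 × Fin k → ℕ
family α β γ (Fin.zero , j) = α j
family α β γ (Fin.suc Fin.zero , j) = β j
family α β γ (Fin.suc (Fin.suc Fin.zero) , j) = γ j

Σ[_] : ∀ {k} → (Fin k → ℕ) → ℕ
Σ[ f ] = VF.foldr _+_ 0 f

-- The 3k values are distinct, lie in [1, 3k+1] and do not contain both 3k and 3k+1, so they
-- are {1, …, 3k+1} with one number m ∈ {3k, 3k+1} removed; since γⱼ = αⱼ + βⱼ they add up to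
-- 2γ, whence 4γ + 2m = (3k+1)(3k+2).  Together with 2α = k(k+1) this gives, modulo S = 6k+1,
-- 16γ ≡ -1 and 144β ≡ 1 when m = 3k+1, and 16γ ≡ 7 and 144β ≡ 73 when m = 3k.  Hence S ∣ γ or
-- S ∣ β forces S = 7 or S = 73 with m = 3k, i.e. 4γ = 14 or 4γ = 1334, which is impossible.
-- Finally S ∤ α = k(k+1)/2 since the prime S exceeds k + 1.
module Submission where

open import Defs
open import Data.Nat using (ℕ; zero; suc; _+_; _*_; _≤_; _<_; z≤n; s≤s; s≤s⁻¹; NonZero; >-nonZero; >-nonZero⁻¹; _≟_)
open import Data.Nat.Properties
  using (≤-refl; ≤∧≢⇒<; ≤-trans; <⇒≱; 1+n≰n; m≤n⇒m≤1+n; m≤n*m; m≤m+n; +-comm; +-assoc; +-cancelʳ-≡; *-cancelˡ-≡; *-comm; *-distribˡ-+; +-commutativeSemigroup; 1+n≢n; >⇒≢; n≤1+n; suc-injective)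
open import Algebra.Properties.CommutativeSemigroup +-commutativeSemigroup using (interchange)
open import Data.Nat.Divisibility using (_∣_; _∣?_; divides; >⇒∤; ∣m+n∣m⇒∣n; ∣m∣n⇒∣m+n; n∣m*n; n∣m*n*o; ∣n⇒∣m*n)
open import Data.Nat.Primality using (Prime; prime?; euclidsLemma; prime⇒irreducible)
open import Data.Nat.Coprimality using (Coprime)
open import Data.Nat.ListAction using (sum)
open import Data.Nat.ListAction.Properties using (sum-++; sum-↭)
open import Data.Nat.Tactic.RingSolver using (solve)
open import Data.Fin using (Fin; toℕ)
import Data.Fin as Fin
open import Data.Fin.Properties using (toℕ<n; toℕ-injective)
open import Data.List using (List; []; _∷_; _++_; length; map; tabulate; allFin; cartesianProduct)
open import Data.List.Properties using (length-map; length-++; length-tabulate; map-++; map-∘; map-tabulate)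
open import Data.List.Membership.Propositional using (_∈_; _∉_)
open import Data.List.Membership.Propositional.Properties using (∈-∃++; ∈-map⁻)
open import Data.List.Membership.DecPropositional _≟_ using (_∈?_)
open import Data.List.Relation.Unary.Any using (here; there)
open import Data.List.Relation.Unary.All.Properties using (¬Any⇒All¬)
open import Data.List.Relation.Unary.AllPairs using (_∷_)
open import Data.List.Relation.Unary.Unique.Propositional using (Unique)
open import Data.List.Relation.Unary.Unique.Propositional.Properties
  using (map⁺; cartesianProduct⁺; allFin⁺; Unique[x∷xs]⇒x∉xs)
open import Data.List.Relation.Binary.Permutation.Propositional using (_↭_; ↭-sym; ↭⇒↭ₛ)
open import Data.List.Relation.Binary.Permutation.Propositional.Properties using (shift; ∈-resp-↭; ↭-length)
import Data.List.Relation.Binary.Permutation.Setoid.Properties as ↭ₛ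
open import Data.Product using (_×_; _,_; ∃-syntax)
open import Data.Sum using (_⊎_; inj₁; inj₂; [_,_]′)
open import Function using (id; _∘_)
open import Relation.Binary.PropositionalEquality
open import Relation.Nullary using (¬_; yes; no; contradiction)
open import Relation.Nullary.Decidable using (from-yes; from-no)

open ≡-Reasoning

InRange : ℕ → List ℕ → Set
InRange N xs = ∀ {y} → y ∈ xs → 1 ≤ y × y ≤ N

Unique-resp-↭ : ∀ {xs ys : List ℕ} → xs ↭ ys → Unique xs → Unique ys
Unique-resp-↭ p = ↭ₛ.Unique-resp-↭ (setoid ℕ) (↭⇒↭ₛ p)

∈⇒↭∷ : ∀ {x} {xs : List ℕ} → x ∈ xs → ∃[ ys ] xs ↭ x ∷ ys
∈⇒↭∷ x∈xs with as , bs , refl ← ∈-∃++ x∈xs = as ++ bs , shift _ as bs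

InRange-pred : ∀ {N xs} → InRange (suc N) xs → suc N ∉ xs → InRange N xs
InRange-pred r N+1∉xs y∈xs with r y∈xs
... | 1≤y , y≤N+1 = 1≤y , s≤s⁻¹ (≤∧≢⇒< y≤N+1 λ { refl → N+1∉xs y∈xs })

remove-max : ∀ {N xs} → Unique xs → InRange (suc N) xs → suc N ∈ xs →
             ∃[ ys ] xs ↭ suc N ∷ ys × Unique ys × InRange N ys
remove-max u r N+1∈xs with ys , p ← ∈⇒↭∷ N+1∈xs with Unique-resp-↭ p u
... | u′@(_ ∷ ys-unique) =
  ys , p , ys-unique , InRange-pred (r ∘ ∈-resp-↭ (↭-sym p) ∘ there) (Unique[x∷xs]⇒x∉xs u′)

length≤N : ∀ {N xs} → Unique xs → InRange N xs → length xs ≤ N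
length≤N {zero} {[]} _ _ = z≤n
length≤N {zero} {_ ∷ _} _ r with r (here refl)
... | 1≤y , y≤0 = contradiction y≤0 (<⇒≱ 1≤y)
length≤N {suc N} {xs} u r with suc N ∈? xs
... | no  N+1∉xs = m≤n⇒m≤1+n (length≤N u (InRange-pred r N+1∉xs))
... | yes N+1∈xs with ys , p , u′ , r′ ← remove-max u r N+1∈xs =
  subst (_≤ suc N) (sym (↭-length p)) (s≤s (length≤N u′ r′))

2*sum≡N*[1+N] : ∀ {N xs} → Unique xs → InRange N xs → length xs ≡ N →
                2 * sum xs ≡ N * suc N
2*sum≡N*[1+N] {zero} {[]} _ _ _ = refl
2*sum≡N*[1+N] {suc N} {xs} u r len with suc N ∈? xs
... | no  N+1∉xs = contradiction (subst (_≤ N) len (length≤N u (InRange-pred r N+1∉xs))) 1+n≰n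
... | yes N+1∈xs with ys , p , u′ , r′ ← remove-max u r N+1∈xs = begin
  2 * sum xs             ≡⟨ cong (2 *_) (sum-↭ p) ⟩
  2 * (suc N + sum ys)   ≡⟨ *-distribˡ-+ 2 (suc N) (sum ys) ⟩
  2 * suc N + 2 * sum ys ≡⟨ cong (2 * suc N +_) (2*sum≡N*[1+N] u′ r′ (suc-injective (trans (sym (↭-length p)) len))) ⟩
  2 * suc N + N * suc N  ≡⟨ solve (N ∷ []) ⟩
  suc N * suc (suc N)    ∎

2*[y+sum]≡[1+N]*[2+N] : ∀ {N xs y} → Unique xs → InRange (suc N) xs → length xs ≡ N →
                        1 ≤ y → y ≤ suc N → y ∉ xs → 2 * (y + sum xs) ≡ suc N * suc (suc N)
2*[y+sum]≡[1+N]*[2+N] {xs = xs} u r len 1≤y y≤N+1 y∉xs =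
  2*sum≡N*[1+N] (¬Any⇒All¬ xs y∉xs ∷ u) r′ (cong suc len)
  where
  r′ : InRange _ (_ ∷ xs)
  r′ (here refl) = 1≤y , y≤N+1
  r′ (there y∈xs) = r y∈xs

length-cartesianProduct : ∀ {A B : Set} (is : List A) (js : List B) →
                          length (cartesianProduct is js) ≡ length is * length js
length-cartesianProduct []       js = refl
length-cartesianProduct (i ∷ is) js = begin
  length (map (i ,_) js ++ cartesianProduct is js)         ≡⟨ length-++ (map (i ,_) js) ⟩
  length (map (i ,_) js) + length (cartesianProduct is js) ≡⟨ cong₂ _+_ (length-map (i ,_) js) (length-cartesianProduct is js) ⟩
  length js + length is * length js                        ∎

sum-map-cartesianProduct : ∀ {A B : Set} (f : A × B → ℕ) (is : List A) (js : List B) →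
  sum (map f (cartesianProduct is js)) ≡ sum (map (λ i → sum (map (λ j → f (i , j)) js)) is)
sum-map-cartesianProduct f []       js = refl
sum-map-cartesianProduct f (i ∷ is) js = begin
  sum (map f (map (i ,_) js ++ cartesianProduct is js))              ≡⟨ cong sum (map-++ f (map (i ,_) js) _) ⟩
  sum (map f (map (i ,_) js) ++ map f (cartesianProduct is js))      ≡⟨ sum-++ (map f (map (i ,_) js)) _ ⟩
  sum (map f (map (i ,_) js)) + sum (map f (cartesianProduct is js)) ≡⟨ cong₂ _+_ (cong sum (sym (map-∘ js))) (sum-map-cartesianProduct f is js) ⟩
  sum (map (λ j → f (i , j)) js) + sum (map (λ i → sum (map (λ j → f (i , j)) js)) is) ∎

sum-tabulate : ∀ {n} (f : Fin n → ℕ) → sum (tabulate f) ≡ Σ[ f ]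
sum-tabulate {zero}  f = refl
sum-tabulate {suc n} f = cong (f Fin.zero +_) (sum-tabulate (f ∘ Fin.suc))

sum-map-allFin : ∀ {n} (f : Fin n → ℕ) → sum (map f (allFin n)) ≡ Σ[ f ]
sum-map-allFin f = trans (cong sum (map-tabulate id f)) (sum-tabulate f)

Σ-+ : ∀ {n} {f g h : Fin n → ℕ} → (∀ j → f j + g j ≡ h j) → Σ[ f ] + Σ[ g ] ≡ Σ[ h ]
Σ-+ {zero}          _ = refl
Σ-+ {suc n} {f} {g} e = begin
  (f Fin.zero + Σ[ f ∘ Fin.suc ]) + (g Fin.zero + Σ[ g ∘ Fin.suc ]) ≡⟨ interchange (f Fin.zero) _ (g Fin.zero) _ ⟩
  (f Fin.zero + g Fin.zero) + (Σ[ f ∘ Fin.suc ] + Σ[ g ∘ Fin.suc ]) ≡⟨ cong₂ _+_ (e Fin.zero) (Σ-+ (e ∘ Fin.suc)) ⟩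
  _                                                                   ∎

2*Σ≡n*[1+n] : ∀ {n} (α : Fin n → ℕ) → (∀ j → α j ≡ suc (toℕ j)) → 2 * Σ[ α ] ≡ n * suc n
2*Σ≡n*[1+n] {n} α α≡1+j =
  subst (λ s → 2 * s ≡ n * suc n) (sum-map-allFin α) (2*sum≡N*[1+N] unique in-range len)
  where
  unique : Unique (map α (allFin n))
  unique = map⁺ (λ {i} {j} αi≡αj →
    toℕ-injective (suc-injective (trans (sym (α≡1+j i)) (trans αi≡αj (α≡1+j j))))) (allFin⁺ n)
  in-range : InRange n (map α (allFin n))
  in-range y∈ with j , _ , refl ← ∈-map⁻ α y∈ rewrite α≡1+j j = s≤s z≤n , toℕ<n j
  len : length (map α (allFin n)) ≡ n
  len = trans (length-map α (allFin n)) (length-tabulate id)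

module _ {n : ℕ} (α β γ : Fin n → ℕ) where

  values : List ℕ
  values = map (family α β γ) (cartesianProduct (allFin 3) (allFin n))

  length-values : length values ≡ 3 * n
  length-values = begin
    length values                                          ≡⟨ length-map (family α β γ) (cartesianProduct (allFin 3) (allFin n)) ⟩
    length (cartesianProduct (allFin 3) (allFin n))        ≡⟨ length-cartesianProduct (allFin 3) (allFin n) ⟩
    3 * length (allFin n)                                  ≡⟨ cong (3 *_) (length-tabulate (id {A = Fin n})) ⟩
    3 * n                                                  ∎

  values-unique : (∀ p q → family α β γ p ≡ family α β γ q → p ≡ q) → Unique values
  values-unique inj = map⁺ (inj _ _) (cartesianProduct⁺ (allFin⁺ 3) (allFin⁺ n))

  sum-values : (∀ j → α j + β j ≡ γ j) → sum values ≡ 2 * Σ[ γ ]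
  sum-values α+β≡γ = begin
    sum values                                             ≡⟨ sum-map-cartesianProduct (family α β γ) (allFin 3) (allFin n) ⟩
    sum (map α L) + (sum (map β L) + (sum (map γ L) + 0))  ≡⟨ cong₂ _+_ (sum-map-allFin α) (cong₂ _+_ (sum-map-allFin β) (cong (_+ 0) (sum-map-allFin γ))) ⟩
    Σ[ α ] + (Σ[ β ] + (Σ[ γ ] + 0))                       ≡⟨ sym (+-assoc Σ[ α ] Σ[ β ] _) ⟩
    (Σ[ α ] + Σ[ β ]) + (Σ[ γ ] + 0)                       ≡⟨ cong (_+ (Σ[ γ ] + 0)) (Σ-+ α+β≡γ) ⟩
    2 * Σ[ γ ]                                             ∎
    where L = allFin n

module _ {n} .{{_ : NonZero n}} {α β γ : Fin n → ℕ}
         (inj : ∀ p q → family α β γ p ≡ family α β γ q → p ≡ q)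
         (range : ∀ p → 1 ≤ family α β γ p × family α β γ p ≤ 3 * n + 1)
         (no-pair : ∀ p q → ¬ (p ≡ q) → ¬ (family α β γ p + family α β γ q ≡ 6 * n + 1))
         (α+β≡γ : ∀ j → α j + β j ≡ γ j) where

  private
    xs : List ℕ
    xs = values α β γ

    in-range : InRange (suc (3 * n)) xs
    in-range y∈xs with p , _ , refl ← ∈-map⁻ (family α β γ) y∈xs with range p
    ... | 1≤y , y≤3n+1 = 1≤y , subst (family α β γ p ≤_) (+-comm (3 * n) 1) y≤3n+1

    missing : ∀ {y} → 1 ≤ y → y ≤ suc (3 * n) → y ∉ xs →
              2 * (y + 2 * Σ[ γ ]) ≡ suc (3 * n) * suc (suc (3 * n))
    missing {y} 1≤y y≤3n+1 y∉xs =
      subst (λ s → 2 * (y + s) ≡ _) (sum-values α β γ α+β≡γ)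
        (2*[y+sum]≡[1+N]*[2+N] (values-unique α β γ inj) in-range (length-values α β γ) 1≤y y≤3n+1 y∉xs)

    3n∉xs : suc (3 * n) ∈ xs → 3 * n ∉ xs
    3n∉xs 3n+1∈xs 3n∈xs
      with p , _ , 3n≡fp   ← ∈-map⁻ (family α β γ) 3n∈xs
         | q , _ , 3n+1≡fq ← ∈-map⁻ (family α β γ) 3n+1∈xs =
      no-pair p q (λ { refl → 1+n≢n (trans 3n+1≡fq (sym 3n≡fp)) }) (begin
        family α β γ p + family α β γ q ≡⟨ cong₂ _+_ (sym 3n≡fp) (sym 3n+1≡fq) ⟩
        3 * n + suc (3 * n)             ≡⟨ solve (n ∷ []) ⟩
        6 * n + 1                       ∎)

  sum-with-missing-value :
    2 * (suc (3 * n) + 2 * Σ[ γ ]) ≡ suc (3 * n) * suc (suc (3 * n)) ⊎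
    2 * (3 * n + 2 * Σ[ γ ]) ≡ suc (3 * n) * suc (suc (3 * n))
  sum-with-missing-value with suc (3 * n) ∈? xs
  ... | no  3n+1∉xs = inj₁ (missing (s≤s z≤n) ≤-refl 3n+1∉xs)
  ... | yes 3n+1∈xs = inj₂ (missing (≤-trans (>-nonZero⁻¹ n) (m≤n*m n 3)) (n≤1+n (3 * n)) (3n∉xs 3n+1∈xs))

∣-residue : ∀ {d a b} r → d ∣ a → d ∣ b → a + r ≡ b → d ∣ r
∣-residue r d∣a d∣b a+r≡b = ∣m+n∣m⇒∣n (subst (_ ∣_) (sym a+r≡b) d∣b) d∣a

∤⇒coprime : ∀ {p x} → Prime p → ¬ p ∣ x → Coprime x p
∤⇒coprime p-prime p∤x (d∣x , d∣p) with prime⇒irreducible p-prime d∣p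
... | inj₁ d≡1  = d≡1
... | inj₂ refl = contradiction d∣x p∤x

4*x+r≢c+r : ∀ x r {c} → ¬ 4 ∣ c → 4 * x + r ≢ c + r
4*x+r≢c+r x r 4∤c eq = 4∤c (divides x (trans (sym (+-cancelʳ-≡ r (4 * x) _ eq)) (*-comm 4 x)))

2+n≤6n+1 : ∀ n .{{_ : NonZero n}} → 2 + n ≤ 6 * n + 1
2+n≤6n+1 (suc k) = subst (3 + k ≤_) (eq k) (m≤m+n (3 + k) (4 + 5 * k))
  where
  eq : ∀ k → 3 + k + (4 + 5 * k) ≡ 6 * suc k + 1
  eq k = solve (k ∷ [])

6n+1-injective : ∀ {m n} → 6 * m + 1 ≡ 6 * n + 1 → m ≡ n
6n+1-injective {m} {n} eq = *-cancelˡ-≡ m n 6 (+-cancelʳ-≡ 1 (6 * m) (6 * n) eq)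

module _ {n : ℕ} .{{_ : NonZero n}} where

  1<6n+1 : 1 < 6 * n + 1
  1<6n+1 = ≤-trans (m≤m+n 2 n) (2+n≤6n+1 n)

  6n+1∤1 : ¬ (6 * n + 1) ∣ 1
  6n+1∤1 = >⇒∤ 1<6n+1

  6n+1∣prime⇒≡ : ∀ {p} → Prime p → (6 * n + 1) ∣ p → 6 * n + 1 ≡ p
  6n+1∣prime⇒≡ p-prime S∣p =
    [ (λ S≡1 → contradiction S≡1 (>⇒≢ 1<6n+1)) , id ]′ (prime⇒irreducible p-prime S∣p)

module _ {n α β γ : ℕ} .{{_ : NonZero n}} (S-prime : Prime (6 * n + 1))
         (2α≡n[1+n] : 2 * α ≡ n * suc n) (α+β≡γ : α + β ≡ γ) where

  6n+1∤α : ¬ (6 * n + 1) ∣ α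
  6n+1∤α S∣α = [ >⇒∤ (≤-trans (n≤1+n (suc n)) (2+n≤6n+1 n)) , >⇒∤ (2+n≤6n+1 n) ]′
    (euclidsLemma n (suc n) S-prime (subst ((6 * n + 1) ∣_) 2α≡n[1+n] (∣n⇒∣m*n 2 S∣α)))

  4β+2n[1+n]≡4γ : 4 * β + 2 * (n * suc n) ≡ 4 * γ
  4β+2n[1+n]≡4γ = begin
    4 * β + 2 * (n * suc n) ≡⟨ cong (λ t → 4 * β + 2 * t) (sym 2α≡n[1+n]) ⟩
    4 * β + 2 * (2 * α)     ≡⟨ solve (α ∷ β ∷ []) ⟩
    4 * (α + β)             ≡⟨ cong (4 *_) α+β≡γ ⟩
    4 * γ                   ∎

  6n+1∣144β+8[6n+1] : (6 * n + 1) ∣ β → (6 * n + 1) ∣ 144 * β + 8 * (6 * n + 1)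
  6n+1∣144β+8[6n+1] S∣β = ∣m∣n⇒∣m+n (∣n⇒∣m*n 144 S∣β) (n∣m*n 8)

  -- The identities below are the congruences modulo 6n + 1 written without subtraction; each
  -- is proved with a summand added to both sides and then cancelled.
  module _ (top-missing : 2 * (suc (3 * n) + 2 * γ) ≡ suc (3 * n) * suc (suc (3 * n))) where

    16γ+1≡[6n+1]² : 16 * γ + 1 ≡ (6 * n + 1) * (6 * n + 1)
    16γ+1≡[6n+1]² = +-cancelʳ-≡ (8 * suc (3 * n)) _ _ (begin
      16 * γ + 1 + 8 * suc (3 * n)              ≡⟨ solve (n ∷ γ ∷ []) ⟩
      4 * (2 * (suc (3 * n) + 2 * γ)) + 1       ≡⟨ cong (λ t → 4 * t + 1) top-missing ⟩
      4 * (suc (3 * n) * suc (suc (3 * n))) + 1 ≡⟨ solve (n ∷ []) ⟩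
      (6 * n + 1) * (6 * n + 1) + 8 * suc (3 * n) ∎)

    7[6n+1]²+1≡144β+8[6n+1] : 7 * (6 * n + 1) * (6 * n + 1) + 1 ≡ 144 * β + 8 * (6 * n + 1)
    7[6n+1]²+1≡144β+8[6n+1] = +-cancelʳ-≡ (36 * (2 * (n * suc n) + 2 * suc (3 * n))) _ _ (begin
      7 * (6 * n + 1) * (6 * n + 1) + 1 + 36 * (2 * (n * suc n) + 2 * suc (3 * n))
        ≡⟨ solve (n ∷ []) ⟩
      36 * (suc (3 * n) * suc (suc (3 * n))) + 8 * (6 * n + 1)
        ≡⟨ cong (λ t → 36 * t + 8 * (6 * n + 1)) (sym top-missing) ⟩
      36 * (2 * (suc (3 * n) + 2 * γ)) + 8 * (6 * n + 1)
        ≡⟨ solve (n ∷ γ ∷ []) ⟩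
      36 * (4 * γ) + 72 * suc (3 * n) + 8 * (6 * n + 1)
        ≡⟨ cong (λ t → 36 * t + 72 * suc (3 * n) + 8 * (6 * n + 1)) (sym 4β+2n[1+n]≡4γ) ⟩
      36 * (4 * β + 2 * (n * suc n)) + 72 * suc (3 * n) + 8 * (6 * n + 1)
        ≡⟨ solve (n ∷ β ∷ []) ⟩
      144 * β + 8 * (6 * n + 1) + 36 * (2 * (n * suc n) + 2 * suc (3 * n)) ∎)

    6n+1∤γ-top : ¬ (6 * n + 1) ∣ γ
    6n+1∤γ-top S∣γ = 6n+1∤1 (∣-residue 1 (∣n⇒∣m*n 16 S∣γ) (n∣m*n (6 * n + 1)) 16γ+1≡[6n+1]²)

    6n+1∤β-top : ¬ (6 * n + 1) ∣ β
    6n+1∤β-top S∣β =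
      6n+1∤1 (∣-residue 1 (n∣m*n*o 7 (6 * n + 1)) (6n+1∣144β+8[6n+1] S∣β) 7[6n+1]²+1≡144β+8[6n+1])

  module _ (3n-missing : 2 * (3 * n + 2 * γ) ≡ suc (3 * n) * suc (suc (3 * n))) where

    4γ+6n≡[3n+1][3n+2] : 4 * γ + 6 * n ≡ suc (3 * n) * suc (suc (3 * n))
    4γ+6n≡[3n+1][3n+2] = begin
      4 * γ + 6 * n                       ≡⟨ solve (n ∷ γ ∷ []) ⟩
      2 * (3 * n + 2 * γ)                 ≡⟨ 3n-missing ⟩
      suc (3 * n) * suc (suc (3 * n))     ∎

    n≢1 : n ≢ 1
    n≢1 n≡1 = 4*x+r≢c+r γ 6 (from-no (4 ∣? 14))
      (subst (λ m → 4 * γ + 6 * m ≡ suc (3 * m) * suc (suc (3 * m))) n≡1 4γ+6n≡[3n+1][3n+2])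

    n≢12 : n ≢ 12
    n≢12 n≡12 = 4*x+r≢c+r γ 72 (from-no (4 ∣? 1334))
      (subst (λ m → 4 * γ + 6 * m ≡ suc (3 * m) * suc (suc (3 * m))) n≡12 4γ+6n≡[3n+1][3n+2])

    [6n+1]²+7≡16γ : (6 * n + 1) * (6 * n + 1) + 7 ≡ 16 * γ
    [6n+1]²+7≡16γ = +-cancelʳ-≡ (24 * n) _ _ (begin
      (6 * n + 1) * (6 * n + 1) + 7 + 24 * n ≡⟨ solve (n ∷ []) ⟩
      4 * (suc (3 * n) * suc (suc (3 * n)))  ≡⟨ cong (4 *_) (sym 3n-missing) ⟩
      4 * (2 * (3 * n + 2 * γ))              ≡⟨ solve (n ∷ γ ∷ []) ⟩
      16 * γ + 24 * n                        ∎)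

    7[6n+1]²+73≡144β+8[6n+1] : 7 * (6 * n + 1) * (6 * n + 1) + 73 ≡ 144 * β + 8 * (6 * n + 1)
    7[6n+1]²+73≡144β+8[6n+1] = +-cancelʳ-≡ (36 * (2 * (n * suc n) + 2 * (3 * n))) _ _ (begin
      7 * (6 * n + 1) * (6 * n + 1) + 73 + 36 * (2 * (n * suc n) + 2 * (3 * n))
        ≡⟨ solve (n ∷ []) ⟩
      36 * (suc (3 * n) * suc (suc (3 * n))) + 8 * (6 * n + 1)
        ≡⟨ cong (λ t → 36 * t + 8 * (6 * n + 1)) (sym 3n-missing) ⟩
      36 * (2 * (3 * n + 2 * γ)) + 8 * (6 * n + 1)
        ≡⟨ solve (n ∷ γ ∷ []) ⟩
      36 * (4 * γ) + 72 * (3 * n) + 8 * (6 * n + 1)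
        ≡⟨ cong (λ t → 36 * t + 72 * (3 * n) + 8 * (6 * n + 1)) (sym 4β+2n[1+n]≡4γ) ⟩
      36 * (4 * β + 2 * (n * suc n)) + 72 * (3 * n) + 8 * (6 * n + 1)
        ≡⟨ solve (n ∷ β ∷ []) ⟩
      144 * β + 8 * (6 * n + 1) + 36 * (2 * (n * suc n) + 2 * (3 * n)) ∎)

    6n+1∤γ-3n : ¬ (6 * n + 1) ∣ γ
    6n+1∤γ-3n S∣γ = n≢1 (6n+1-injective (6n+1∣prime⇒≡ (from-yes (prime? 7))
      (∣-residue 7 (n∣m*n (6 * n + 1)) (∣n⇒∣m*n 16 S∣γ) [6n+1]²+7≡16γ)))

    6n+1∤β-3n : ¬ (6 * n + 1) ∣ β
    6n+1∤β-3n S∣β = n≢12 (6n+1-injective (6n+1∣prime⇒≡ (from-yes (prime? 73))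
      (∣-residue 73 (n∣m*n*o 7 (6 * n + 1)) (6n+1∣144β+8[6n+1] S∣β) 7[6n+1]²+73≡144β+8[6n+1])))

  coprime-sums :
    2 * (suc (3 * n) + 2 * γ) ≡ suc (3 * n) * suc (suc (3 * n)) ⊎
    2 * (3 * n + 2 * γ) ≡ suc (3 * n) * suc (suc (3 * n)) →
    Coprime α (6 * n + 1) × Coprime β (6 * n + 1) × Coprime γ (6 * n + 1)
  coprime-sums missing =
    ∤⇒coprime S-prime 6n+1∤α ,
    ∤⇒coprime S-prime ([ 6n+1∤β-top , 6n+1∤β-3n ]′ missing) ,
    ∤⇒coprime S-prime ([ 6n+1∤γ-top , 6n+1∤γ-3n ]′ missing)

lemma6p4 : (k : ℕ) → 1 ≤ k →
    (α β γ : Fin k → ℕ) →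
    (∀ p q → family α β γ p ≡ family α β γ q → p ≡ q) →
    (∀ p → 1 ≤ family α β γ p × family α β γ p ≤ 3 * k + 1) →
    (∀ p q → ¬ (p ≡ q) → ¬ (family α β γ p + family α β γ q ≡ 6 * k + 1)) →
    (∀ j → α j ≡ suc (toℕ j)) →
    (∀ j → α j < β j × β j < γ j) →
    (∀ j → α j + β j ≡ γ j) →
    Prime (6 * k + 1) →
    Coprime Σ[ α ] (6 * k + 1) × Coprime Σ[ β ] (6 * k + 1) × Coprime Σ[ γ ] (6 * k + 1)
lemma6p4 k 1≤k α β γ inj range no-pair α≡1+j _ α+β≡γ S-prime =
  coprime-sums S-prime (2*Σ≡n*[1+n] α α≡1+j) (Σ-+ α+β≡γ)
    (sum-with-missing-value inj range no-pair α+β≡γ)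
  where
  instance
    k≢0 : NonZero k
    k≢0 = >-nonZero 1≤k
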